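{- The theory $\mathsf{PA}^-_{\mathsf{smu}}$ proves: if $\mathsf{pow}_2(x)$ and $\mathsf{pow}_2(y)$, then $\mathsf{pow}_2(x\cdot y)$.
   Context: $\mathsf{PA}^-$ is the theory, in the language $0,1,+,\times,\leq$, of the non-negative parts of discretely ordered commutative rings. $x\mid y$ means $\exists z\,z\cdot x=y$; $2:=1+1$; $\mathsf{pow}_2(x)$ means $\forall y\,(y\mid x\to(y=1\vee 2\mid y))$. $\mathsf{PA}^-_{\mathsf{smu}}$ is $\mathsf{PA}^-$ plus the axioms $\forall x\,\exists y\,(\mathsf{pow}_2(y)\wedge y\leq x+1<2y)$ and $(\mathsf{pow}_2(x)\wedge\mathsf{pow}_2(y)\wedge x\leq y)\to x\mid y$. -}

module Defs where

open import Level using (0ℓ)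
open import Data.Product using (Σ; _×_; _,_)
open import Data.Sum using (_⊎_)
open import Relation.Nullary using (¬_)
open import Relation.Binary.PropositionalEquality using (_≡_)

-- A model (L-structure) of PA⁻ in the language 0,1,+,×,≤ (Kaye's axioms),
-- with = interpreted as genuine equality on the carrier.
record PA⁻Model : Set₁ where
  infixl 6 _+_
  infixl 7 _*_
  infix 4 _≤_ _<_
  field
    M   : Set
    𝟘 𝟙 : M
    _+_ _*_ : M → M → M
    _≤_ : M → M → Set

  _<_ : M → M → Set
  x < y = (x ≤ y) × ¬ (x ≡ y)

  field
    +-assoc  : ∀ x y z → (x + y) + z ≡ x + (y + z)
    +-comm   : ∀ x y → x + y ≡ y + x
    *-assoc  : ∀ x y z → (x * y) * z ≡ x * (y * z)
    *-comm   : ∀ x y → x * y ≡ y * x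
    distrib  : ∀ x y z → x * (y + z) ≡ x * y + x * z
    +-identʳ : ∀ x → x + 𝟘 ≡ x
    *-zeroʳ  : ∀ x → x * 𝟘 ≡ 𝟘
    *-identʳ : ∀ x → x * 𝟙 ≡ x
    ≤-refl    : ∀ x → x ≤ x
    ≤-antisym : ∀ x y → x ≤ y → y ≤ x → x ≡ y
    ≤-trans   : ∀ x y z → x ≤ y → y ≤ z → x ≤ z
    ≤-total   : ∀ x y → (x ≤ y) ⊎ (y ≤ x)
    +-mono-<  : ∀ x y z → x < y → x + z < y + z
    *-mono-<  : ∀ x y z → 𝟘 < z → x < y → x * z < y * z
    ≤-diff    : ∀ x y → x ≤ y → Σ M (λ z → x + z ≡ y)
    0<1       : 𝟘 < 𝟙
    discrete  : ∀ x → 𝟘 < x → 𝟙 ≤ x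
    0≤        : ∀ x → 𝟘 ≤ x

  _∣_ : M → M → Set
  x ∣ y = Σ M (λ z → z * x ≡ y)

  𝟚 : M
  𝟚 = 𝟙 + 𝟙

  pow₂ : M → Set
  pow₂ x = ∀ y → y ∣ x → (y ≡ 𝟙) ⊎ (𝟚 ∣ y)

record PA⁻smuModel : Set₁ where
  field
    base : PA⁻Model
  open PA⁻Model base public
  field
    smu-exists : ∀ x → Σ M (λ y → pow₂ y × (y ≤ x + 𝟙) × (x + 𝟙 < 𝟚 * y))
    smu-divides : ∀ x y → pow₂ x → pow₂ y → x ≤ y → x ∣ y

{-# OPTIONS --safe #-}
-- Let z be the power of two with z ≤ xy < 2z. Under the smu axioms powers of two are
-- linearly ordered by divisibility, and they are closed under divisors. Comparing x with z,
-- and then the cofactor z / x with y, gives z ∣ xy or xy ∣ z; in either case the bounds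
-- z ≤ xy < 2z force xy = z, a power of two.
module Submission where

open import Defs
open import Level using (0ℓ)
open import Axiom.ExcludedMiddle using (ExcludedMiddle)
open import Data.Product using (Σ; _×_; _,_; proj₁)
open import Data.Sum using (_⊎_; inj₁; inj₂)
open import Data.Empty using (⊥-elim)
open import Relation.Nullary using (¬_; yes; no)
open import Relation.Binary.PropositionalEquality using (_≡_; refl; sym; trans; cong; subst; subst₂)

module PA⁻Properties (𝓜 : PA⁻Model) where
  open PA⁻Model 𝓜

  *-identˡ : ∀ x → 𝟙 * x ≡ x
  *-identˡ x = trans (*-comm 𝟙 x) (*-identʳ x)

  *-zeroˡ : ∀ x → 𝟘 * x ≡ 𝟘
  *-zeroˡ x = trans (*-comm 𝟘 x) (*-zeroʳ x)

  ∣-trans : ∀ {x y z} → x ∣ y → y ∣ z → x ∣ z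
  ∣-trans {x} (a , ax≡y) (b , by≡z) =
    b * a , trans (*-assoc b a x) (trans (cong (b *_) ax≡y) by≡z)

  m∣m*n : ∀ x y → x ∣ (x * y)
  m∣m*n x y = y , *-comm y x

  quotient-∣ : ∀ {x z} (x∣z : x ∣ z) → proj₁ x∣z ∣ z
  quotient-∣ {x} (a , ax≡z) = x , trans (*-comm x a) ax≡z

  *-monoˡ-∣ : ∀ {x y} z → x ∣ y → (x * z) ∣ (y * z)
  *-monoˡ-∣ {x} z (a , ax≡y) = a , trans (sym (*-assoc a x z)) (cong (_* z) ax≡y)

  pow₂-∣ : ∀ {d x} → d ∣ x → pow₂ x → pow₂ d
  pow₂-∣ d∣x px e e∣d = px e (∣-trans e∣d d∣x)

  *-pos : ∀ {x y} → 𝟘 < x → 𝟘 < y → 𝟘 < x * y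
  *-pos {x} {y} 0<x 0<y = subst (_< x * y) (*-zeroˡ y) (*-mono-< 𝟘 x y 0<y 0<x)

  ≤-<-trans : ∀ {x y z} → x ≤ y → y < z → x < z
  ≤-<-trans {x} {y} {z} x≤y (y≤z , y≢z) =
    ≤-trans x y z x≤y y≤z ,
    λ x≡z → y≢z (≤-antisym y z y≤z (subst (_≤ y) x≡z x≤y))

  n≮0 : ∀ {x} → ¬ (x < 𝟘)
  n≮0 {x} x<0 with ≤-<-trans (0≤ x) x<0
  ... | _ , 0≢0 = 0≢0 refl

  ≢𝟘⇒𝟘< : ∀ {x} → ¬ x ≡ 𝟘 → 𝟘 < x
  ≢𝟘⇒𝟘< {x} x≢0 = 0≤ x , λ 0≡x → x≢0 (sym 0≡x)

  <𝟚*⇒𝟘< : ∀ {x d} → x < 𝟚 * d → 𝟘 < d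
  <𝟚*⇒𝟘< {x} {d} x<2d = ≢𝟘⇒𝟘< λ { refl → n≮0 (subst (x <_) (*-zeroʳ 𝟚) x<2d) }

  -- Equality in a model need not be decidable, so passing from the strict monotonicity
  -- axioms to their non-strict forms uses excluded middle.
  module Classical (em : ExcludedMiddle 0ℓ) where

    +-monoʳ-≤ : ∀ {x y} z → x ≤ y → z + x ≤ z + y
    +-monoʳ-≤ {x} {y} z x≤y with em {x ≡ y}
    ... | yes refl = ≤-refl (z + x)
    ... | no x≢y   = subst₂ _≤_ (+-comm x z) (+-comm y z) (proj₁ (+-mono-< x y z (x≤y , x≢y)))

    *-monoˡ-≤ : ∀ {x y} z → x ≤ y → x * z ≤ y * z
    *-monoˡ-≤ {x} {y} z x≤y with em {z ≡ 𝟘} | em {x ≡ y}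
    ... | yes refl | _        = subst₂ _≤_ (sym (*-zeroʳ x)) (sym (*-zeroʳ y)) (≤-refl 𝟘)
    ... | no _     | yes refl = ≤-refl (x * z)
    ... | no z≢0   | no x≢y   = proj₁ (*-mono-< x y z (≢𝟘⇒𝟘< z≢0) (x≤y , x≢y))

    <⇒+𝟙≤ : ∀ {x y} → x < y → x + 𝟙 ≤ y
    <⇒+𝟙≤ {x} {y} (x≤y , x≢y) with ≤-diff x y x≤y
    ... | d , x+d≡y with em {d ≡ 𝟘}
    ...   | yes refl = ⊥-elim (x≢y (trans (sym (+-identʳ x)) x+d≡y))
    ...   | no d≢0   = subst (x + 𝟙 ≤_) x+d≡y (+-monoʳ-≤ x (discrete d (≢𝟘⇒𝟘< d≢0)))

    𝟚≤ : ∀ {b} → ¬ b ≡ 𝟘 → ¬ b ≡ 𝟙 → 𝟚 ≤ b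
    𝟚≤ {b} b≢0 b≢1 = <⇒+𝟙≤ (discrete b (≢𝟘⇒𝟘< b≢0) , λ 1≡b → b≢1 (sym 1≡b))

    ∣⇒≤ : ∀ {d x} → d ∣ x → 𝟘 < x → d ≤ x
    ∣⇒≤ {d} (c , cd≡x) (_ , 0≢x) with em {c ≡ 𝟘}
    ... | yes refl = ⊥-elim (0≢x (trans (sym (*-zeroˡ d)) cd≡x))
    ... | no c≢0   =
      subst₂ _≤_ (*-identˡ d) cd≡x (*-monoˡ-≤ d (discrete c (≢𝟘⇒𝟘< c≢0)))

    ∣-≤⇒≡ : ∀ {d x} → d ∣ x → 𝟘 < x → x ≤ d → x ≡ d
    ∣-≤⇒≡ {d} {x} d∣x 0<x x≤d = ≤-antisym x d x≤d (∣⇒≤ d∣x 0<x)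

    ∣-<𝟚*⇒≡ : ∀ {d x} → d ∣ x → 𝟘 < x → x < 𝟚 * d → x ≡ d
    ∣-<𝟚*⇒≡ {d} {x} (b , bd≡x) (_ , 0≢x) x<2d with em {b ≡ 𝟘} | em {b ≡ 𝟙}
    ... | yes refl | _        = ⊥-elim (0≢x (trans (sym (*-zeroˡ d)) bd≡x))
    ... | no _     | yes refl = trans (sym bd≡x) (*-identˡ d)
    ... | no b≢0   | no b≢1   with ≤-<-trans (subst (𝟚 * d ≤_) bd≡x (*-monoˡ-≤ d (𝟚≤ b≢0 b≢1))) x<2d
    ...   | _ , 2d≢2d = ⊥-elim (2d≢2d refl)

module PA⁻smuProperties (em : ExcludedMiddle 0ℓ) (𝓜 : PA⁻smuModel) where
  open PA⁻smuModel 𝓜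
  open PA⁻Properties base
  open Classical em

  pow₂-∣-total : ∀ {x y} → pow₂ x → pow₂ y → x ∣ y ⊎ y ∣ x
  pow₂-∣-total {x} {y} px py with ≤-total x y
  ... | inj₁ x≤y = inj₁ (smu-divides x y px py x≤y)
  ... | inj₂ y≤x = inj₂ (smu-divides y x py px y≤x)

  pow₂-between : ∀ {x} → 𝟘 < x → Σ M λ z → pow₂ z × z ≤ x × x < 𝟚 * z
  pow₂-between {x} 0<x with ≤-diff 𝟙 x (discrete x 0<x)
  ... | w , 1+w≡x with smu-exists w
  ...   | z , pz , z≤w+1 , w+1<2z = z , pz , subst (z ≤_) w+1≡x z≤w+1 , subst (_< 𝟚 * z) w+1≡x w+1<2z
    where
    w+1≡x : w + 𝟙 ≡ x
    w+1≡x = trans (+-comm w 𝟙) 1+w≡x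

  pow₂-∣-total-* : ∀ {x y z} → pow₂ x → pow₂ y → pow₂ z → z ∣ (x * y) ⊎ (x * y) ∣ z
  pow₂-∣-total-* {x} {y} {z} px py pz with pow₂-∣-total pz px
  ... | inj₁ z∣x = inj₁ (∣-trans z∣x (m∣m*n x y))
  ... | inj₂ x∣z@(a , ax≡z) with pow₂-∣-total (pow₂-∣ (quotient-∣ x∣z) pz) py
  ...   | inj₁ a∣y = inj₁ (subst₂ _∣_ ax≡z (*-comm y x) (*-monoˡ-∣ x a∣y))
  ...   | inj₂ y∣a = inj₂ (subst₂ _∣_ (*-comm y x) ax≡z (*-monoˡ-∣ x y∣a))

  pow₂-*-pos : ∀ {x y} → 𝟘 < x * y → pow₂ x → pow₂ y → pow₂ (x * y)
  pow₂-*-pos 0<xy px py with pow₂-between 0<xy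
  ... | z , pz , z≤xy , xy<2z with pow₂-∣-total-* px py pz
  ...   | inj₁ z∣xy = subst pow₂ (sym (∣-<𝟚*⇒≡ z∣xy 0<xy xy<2z)) pz
  ...   | inj₂ xy∣z = subst pow₂ (∣-≤⇒≡ xy∣z (<𝟚*⇒𝟘< xy<2z) z≤xy) pz

  pow₂-* : ∀ x y → pow₂ x → pow₂ y → pow₂ (x * y)
  pow₂-* x y px py with em {x ≡ 𝟘} | em {y ≡ 𝟘}
  ... | yes refl | _        = subst pow₂ (sym (*-zeroˡ y)) px
  ... | no _     | yes refl = subst pow₂ (sym (*-zeroʳ x)) py
  ... | no x≢0   | no y≢0   = pow₂-*-pos (*-pos (≢𝟘⇒𝟘< x≢0) (≢𝟘⇒𝟘< y≢0)) px py

mainTheorem13 : ExcludedMiddle 0ℓ → (𝓜 : PA⁻smuModel) →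
    let open PA⁻smuModel 𝓜 in
      ∀ x y → pow₂ x → pow₂ y → pow₂ (x * y)
mainTheorem13 em 𝓜 = PA⁻smuProperties.pow₂-* em 𝓜
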